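{- Let $m\in\mathbb{N}$, let $\mathcal{C}=\{\{(1,0),(0,1)\},\{(0,0)\},\{(1,1)\}\}$, and let $f:\binom{[m]}{2}\to\mathcal{C}$ be any function. Let $A$ be the set of functions $g:[m]\to\{0,1\}$ such that $(g(a),g(b))\notin f(\{a,b\})$ for every pair $a,b\in[m]$ with $a<b$. Then $|A|\le m+1$.
   Context: $[m]=\{1,\ldots,m\}$ and $\binom{[m]}{2}$ is the set of $2$-element subsets of $[m]$. -}

module Defs where

open import Data.Bool using (Bool; true; false; _∧_; not; if_then_else_)
open import Data.Bool.Properties using () renaming (_≟_ to _≟ᵇ_)
open import Data.Nat using (ℕ; zero; suc)
open import Data.Fin using (Fin; _<_)
open import Data.List using (List; []; _∷_; map; _++_; filter; length)
open import Data.Vec using (Vec; []; _∷_; lookup)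
open import Data.Product using (_×_; _,_)
open import Relation.Binary.PropositionalEquality using (_≡_; _≢_)
open import Relation.Nullary using (¬_)

-- The family 𝒞 = { {(1,0),(0,1)}, {(0,0)}, {(1,1)} } of subsets of {0,1}².
-- We encode 0 as false and 1 as true.
data 𝒞 : Set where
  diff  : 𝒞
  zeros : 𝒞
  ones  : 𝒞

_∈𝒞_ : Bool × Bool → 𝒞 → Set
(x , y) ∈𝒞 diff  = x ≢ y
(x , y) ∈𝒞 zeros = (x ≡ false) × (y ≡ false)
(x , y) ∈𝒞 ones  = (x ≡ true) × (y ≡ true)

-- A function g : [m] → {0,1} is represented as a vector of m Booleans
-- (g(a) = lookup g a). f : ([m] choose 2) → 𝒞 is given as a function on
-- ordered pairs a < b (f {a,b} = f a b a<b).
InA : (m : ℕ) → ((a b : Fin m) → a < b → 𝒞) → Vec Bool m → Set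
InA m f g = (a b : Fin m) (a<b : a < b) → ¬ ((lookup g a , lookup g b) ∈𝒞 f a b a<b)

{-# OPTIONS --safe #-}
module Submission where

-- Induct on m by splitting the admissible vectors according to their first
-- coordinate. The tails of each half are admissible for f restricted to
-- {2,…,m}. A tail t occurring in both halves must avoid f({1,b}) both after a 0
-- and after a 1, and for every c ∈ 𝒞 this determines t(b); so at most one tail
-- is shared, and the two halves together lose at most one vector.

open import Defs
open import Data.Nat using (ℕ; _≤_; _+_; zero; suc; z≤n; s≤s)
open import Data.Nat.Properties using (≤-trans; ≤-reflexive; +-suc; +-monoʳ-≤; module ≤-Reasoning)
open import Data.Fin using (Fin; _<_) renaming (zero to fzero; suc to fsuc)
open import Data.Bool using (Bool; true; false)
import Data.Bool.Properties as Bool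
open import Data.Vec using (Vec; []; _∷_; lookup; tabulate)
open import Data.Vec.Properties using (≡-dec; tabulate∘lookup; tabulate-cong)
open import Data.List using (List; []; _∷_; _++_; length; filter)
open import Data.List.Properties using (length-++; filter-all)
open import Data.List.Relation.Unary.All as All using (All; []; _∷_)
open import Data.List.Relation.Unary.AllPairs using ([]; _∷_)
open import Data.List.Relation.Unary.Unique.Propositional using (Unique)
import Data.List.Relation.Unary.Unique.Propositional.Properties as Unique
open import Data.List.Membership.Propositional using (_∈_)
open import Data.List.Membership.Propositional.Properties using (∈-++⁻; ∈-filter⁻)
open import Data.Product using (∃-syntax; _×_; _,_)
open import Data.Sum using (_⊎_; inj₁; inj₂)
open import Data.Empty using (⊥-elim)
open import Function using (_∘_)
open import Relation.Nullary using (¬_; ¬?; yes; no)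
open import Relation.Nullary.Irrelevant using (Irrelevant)
open import Relation.Binary.Definitions using (DecidableEquality)
open import Relation.Binary.PropositionalEquality
  using (_≡_; refl; sym; trans; cong; module ≡-Reasoning)

Unique-irrelevant⇒length≤1 : ∀ {a} {A : Set a} {xs : List A} →
  Irrelevant A → Unique xs → length xs ≤ 1
Unique-irrelevant⇒length≤1 {xs = []}         _   _               = z≤n
Unique-irrelevant⇒length≤1 {xs = _ ∷ []}     _   _               = s≤s z≤n
Unique-irrelevant⇒length≤1 {xs = x ∷ y ∷ _}  irr ((x≢y ∷ _) ∷ _) = ⊥-elim (x≢y (irr x y))

module _ {a} {A : Set a} (_≟_ : DecidableEquality A) where

  Unique⇒length≤1+length-filter-≢ : ∀ t {xs : List A} → Unique xs →
    length xs ≤ suc (length (filter (λ y → ¬? (y ≟ t)) xs))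
  Unique⇒length≤1+length-filter-≢ t {[]}     _ = z≤n
  Unique⇒length≤1+length-filter-≢ t {x ∷ xs} (x∉xs ∷ u) with x ≟ t
  ... | yes refl = ≤-reflexive (cong (suc ∘ length)
                     (sym (filter-all (λ y → ¬? (y ≟ t)) (All.map (_∘ sym) x∉xs))))
  ... | no _     = s≤s (Unique⇒length≤1+length-filter-≢ t u)

module Tails {a} {A : Set a} (_≟_ : DecidableEquality A) where

  tailsWith : ∀ {n} → A → List (Vec A (suc n)) → List (Vec A n)
  tailsWith b []             = []
  tailsWith b ((c ∷ t) ∷ xs) with b ≟ c
  ... | yes _ = t ∷ tailsWith b xs
  ... | no _  = tailsWith b xs

  All-tailsWith : ∀ {p n} {P : Vec A (suc n) → Set p} b {xs} →
    All P xs → All (P ∘ (b ∷_)) (tailsWith b xs)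
  All-tailsWith b {[]}           []       = []
  All-tailsWith b {(c ∷ t) ∷ xs} (p ∷ ps) with b ≟ c
  ... | yes refl = p ∷ All-tailsWith b ps
  ... | no _     = All-tailsWith b ps

  Unique-tailsWith : ∀ {n} b {xs : List (Vec A (suc n))} →
    Unique xs → Unique (tailsWith b xs)
  Unique-tailsWith b {[]}           []         = []
  Unique-tailsWith b {(c ∷ t) ∷ xs} (t∉xs ∷ u) with b ≟ c
  ... | yes refl = All.map (_∘ cong (b ∷_)) (All-tailsWith b t∉xs) ∷ Unique-tailsWith b u
  ... | no _     = Unique-tailsWith b u

open Tails Bool._≟_

length≡length-tailsWith-false+true : ∀ {n} (xs : List (Vec Bool (suc n))) →
  length xs ≡ length (tailsWith false xs) + length (tailsWith true xs)
length≡length-tailsWith-false+true []                 = refl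
length≡length-tailsWith-false+true ((false ∷ _) ∷ xs) = cong suc (length≡length-tailsWith-false+true xs)
length≡length-tailsWith-false+true ((true ∷ _) ∷ xs)  =
  trans (cong suc (length≡length-tailsWith-false+true xs)) (sym (+-suc _ _))

-- No x avoids both (false , x) and (true , x) in diff, so forced diff is arbitrary.
forced : 𝒞 → Bool
forced diff  = false
forced zeros = true
forced ones  = false

∉𝒞-after-both⇒≡forced : ∀ c x →
  ¬ ((false , x) ∈𝒞 c) → ¬ ((true , x) ∈𝒞 c) → x ≡ forced c
∉𝒞-after-both⇒≡forced diff  false _  ∉₁ = ⊥-elim (∉₁ λ ())
∉𝒞-after-both⇒≡forced diff  true  ∉₀ _  = ⊥-elim (∉₀ λ ())
∉𝒞-after-both⇒≡forced zeros false ∉₀ _  = ⊥-elim (∉₀ (refl , refl))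
∉𝒞-after-both⇒≡forced zeros true  _  _  = refl
∉𝒞-after-both⇒≡forced ones  false _  _  = refl
∉𝒞-after-both⇒≡forced ones  true  _  ∉₁ = ⊥-elim (∉₁ (refl , refl))

module _ {n} (f : (a b : Fin (suc n)) → a < b → 𝒞) where

  restrict : (a b : Fin n) → a < b → 𝒞
  restrict a b a<b = f (fsuc a) (fsuc b) (s≤s a<b)

  InA-tail : ∀ {b t} → InA (suc n) f (b ∷ t) → InA n restrict t
  InA-tail g∈A a b a<b = g∈A (fsuc a) (fsuc b) (s≤s a<b)

  forcedTail : Vec Bool n
  forcedTail = tabulate λ b → forced (f fzero (fsuc b) (s≤s z≤n))

  sharedTail⇒≡forcedTail : ∀ {t} →
    InA (suc n) f (false ∷ t) → InA (suc n) f (true ∷ t) → t ≡ forcedTail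
  sharedTail⇒≡forcedTail {t} ∈A₀ ∈A₁ = begin
    t                    ≡⟨ tabulate∘lookup t ⟨
    tabulate (lookup t)  ≡⟨ tabulate-cong (λ b → ∉𝒞-after-both⇒≡forced _ (lookup t b)
                              (∈A₀ fzero (fsuc b) (s≤s z≤n)) (∈A₁ fzero (fsuc b) (s≤s z≤n))) ⟩
    forcedTail           ∎
    where open ≡-Reasoning

  InA-drop-first : ∀ {xs} → Unique xs → All (InA (suc n) f) xs →
    ∃[ ys ] Unique ys × All (InA n restrict) ys × length xs ≤ suc (length ys)
  InA-drop-first {xs} u valid = T₀ ++ F , unique , All.tabulate (valid-merged ∘ ∈-++⁻ T₀) , shrink
    where
    _≟ᵥ_ = ≡-dec Bool._≟_
    T₀ = tailsWith false xs
    T₁ = tailsWith true xs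
    ≢forced? = λ (y : Vec Bool n) → ¬? (y ≟ᵥ forcedTail)
    F = filter ≢forced? T₁

    valid₀ : All (InA (suc n) f ∘ (false ∷_)) T₀
    valid₀ = All-tailsWith false valid
    valid₁ : All (InA (suc n) f ∘ (true ∷_)) T₁
    valid₁ = All-tailsWith true valid

    disjoint : ∀ {v} → ¬ (v ∈ T₀ × v ∈ F)
    disjoint (v∈T₀ , v∈F) with ∈-filter⁻ ≢forced? {xs = T₁} v∈F
    ... | v∈T₁ , v≢forced = v≢forced
      (sharedTail⇒≡forcedTail (All.lookup valid₀ v∈T₀) (All.lookup valid₁ v∈T₁))

    unique : Unique (T₀ ++ F)
    unique = Unique.++⁺ (Unique-tailsWith false u)
      (Unique.filter⁺ ≢forced? (Unique-tailsWith true u)) disjoint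

    valid-merged : ∀ {v} → v ∈ T₀ ⊎ v ∈ F → InA n restrict v
    valid-merged (inj₁ v∈T₀) = InA-tail (All.lookup valid₀ v∈T₀)
    valid-merged (inj₂ v∈F) with ∈-filter⁻ ≢forced? {xs = T₁} v∈F
    ... | v∈T₁ , _ = InA-tail (All.lookup valid₁ v∈T₁)

    shrink : length xs ≤ suc (length (T₀ ++ F))
    shrink = begin
      length xs                       ≡⟨ length≡length-tailsWith-false+true xs ⟩
      length T₀ + length T₁           ≤⟨ +-monoʳ-≤ (length T₀) (Unique⇒length≤1+length-filter-≢ _≟ᵥ_
                                           forcedTail (Unique-tailsWith true u)) ⟩
      length T₀ + suc (length F)      ≡⟨ +-suc (length T₀) (length F) ⟩
      suc (length T₀ + length F)      ≡⟨ cong suc (length-++ T₀) ⟨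
      suc (length (T₀ ++ F))          ∎
      where open ≤-Reasoning

lemma3p1 : (m : ℕ) (f : (a b : Fin m) → a < b → 𝒞)
           (xs : List (Vec Bool m)) → Unique xs → All (InA m f) xs →
           length xs ≤ suc m
lemma3p1 zero    f xs u _ = Unique-irrelevant⇒length≤1 (λ { [] [] → refl }) u
lemma3p1 (suc m) f xs u valid with InA-drop-first f u valid
... | ys , u′ , valid′ , shrink = ≤-trans shrink (s≤s (lemma3p1 m (restrict f) ys u′ valid′))
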